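{- Let $\kappa,t,\ell$ be positive integers such that $\ell<t\le\kappa/16$. Then for any $\kappa$-vertex graph $H$ that does not contain $K_{t,t}$ as a (not necessarily induced) subgraph, the number of (not necessarily induced) copies of $K_{\ell,\ell}$ in $H$ is at most $$\left(2\cdot e^{ -\frac{\ell^2}{16t}}\right)\cdot\binom{\kappa}{\ell}\binom{\kappa-\ell}{\ell}.$$
   Context: $K_{a,b}$ denotes the complete bipartite graph with parts of sizes $a$ and $b$. A (not necessarily induced) copy of $K_{\ell,\ell}$ in $H$ is an ordered pair $(S,T)$ of $\ell$-element vertex subsets of $H$ such that every vertex of $S$ is adjacent to every vertex of $T$ (graphs are simple, so $S,T$ are disjoint). -}

module Defs where

open import Data.Bool using (Bool; true; false; _∧_; _∨_; not; T)
open import Data.Nat as ℕ using (ℕ; zero; suc; _*_; _∸_)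
open import Data.Integer using (+_)
open import Data.Rational as ℚ using (ℚ; _/_; 0ℚ; 1ℚ)
open import Data.Fin using (Fin)
open import Data.Fin.Subset using (Subset; _∈_; ∣_∣)
open import Data.Vec using (Vec; []; _∷_)
open import Data.List using (List; []; _∷_; map; _++_; length; filterᵇ; allFin; cartesianProduct)
open import Data.Product using (Σ; _×_; _,_; proj₁; proj₂)
open import Relation.Binary.PropositionalEquality using (_≡_)

record Graph (κ : ℕ) : Set where
  field
    adj   : Fin κ → Fin κ → Bool
    sym   : ∀ i j → adj i j ≡ adj j i
    irrefl : ∀ i → adj i i ≡ false
open Graph public

Adj : ∀ {κ} → Graph κ → Fin κ → Fin κ → Set
Adj H i j = T (adj H i j)

IsCopy : ∀ {κ} → Graph κ → ℕ → Subset κ → Subset κ → Set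
IsCopy H ℓ S U = (∣ S ∣ ≡ ℓ) × (∣ U ∣ ≡ ℓ) × (∀ i j → i ∈ S → j ∈ U → Adj H i j)

ContainsK : ∀ {κ} → Graph κ → ℕ → Set
ContainsK H t = Σ (Subset _) λ S → Σ (Subset _) λ U → IsCopy H t S U

allSubsets : (n : ℕ) → List (Subset n)
allSubsets zero = [] ∷ []
allSubsets (suc n) = map (true ∷_) (allSubsets n) ++ map (false ∷_) (allSubsets n)

_==_ : ℕ → ℕ → Bool
m == n = Relation.Nullary.Decidable.⌊ m ℕ.≟ n ⌋
  where import Relation.Nullary.Decidable

memᵇ : ∀ {n} → Fin n → Subset n → Bool
memᵇ Fin.zero (b ∷ _) = b
memᵇ (Fin.suc i) (_ ∷ s) = memᵇ i s

allᵇ : {A : Set} → (A → Bool) → List A → Bool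
allᵇ p [] = true
allᵇ p (x ∷ xs) = p x ∧ allᵇ p xs

isCopyᵇ : ∀ {κ} → Graph κ → ℕ → Subset κ → Subset κ → Bool
isCopyᵇ {κ} H ℓ S U =
  (∣ S ∣ == ℓ) ∧ (∣ U ∣ == ℓ) ∧
  allᵇ (λ i → allᵇ (λ j → not (memᵇ i S ∧ memᵇ j U) ∨ adj H i j) (allFin κ)) (allFin κ)

copies : ∀ {κ} → Graph κ → ℕ → ℕ
copies {κ} H ℓ =
  length (filterᵇ (λ p → isCopyᵇ H ℓ (proj₁ p) (proj₂ p))
                  (cartesianProduct (allSubsets κ) (allSubsets κ)))

expTerm : ℚ → ℕ → ℚ
expTerm x zero = 1ℚ
expTerm x (suc k) = expTerm x k ℚ.* x ℚ.* (+ 1 / suc k)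

expPartial : ℚ → ℕ → ℚ
expPartial x zero = 1ℚ
expPartial x (suc n) = expPartial x n ℚ.+ expTerm x (suc n)

-- For x ≥ 0 and c, N ∈ ℕ:  c ≤ 2·e^{-x}·N  ⟺  c·e^{x} ≤ 2N  ⟺  ∀ n, c·Σ_{k≤n} x^k/k! ≤ 2N,
-- since the partial sums increase to e^{x}.
LeTwoExpNegTimes : ℕ → ℚ → ℕ → Set
LeTwoExpNegTimes c x N = ∀ n → (+ c / 1) ℚ.* expPartial x n ℚ.≤ (+ (2 * N) / 1)

ratio : ℕ → ℕ → ℚ
ratio ℓ zero = 0ℚ
ratio ℓ (suc t) = + (ℓ * ℓ) / (16 * suc t)

module Submission where

-- Let N(S) be the common neighbourhood of S, so that H has Σ_{|S|=ℓ} C(|N(S)|,ℓ) copies of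
-- K_{ℓ,ℓ}. Fix D ≥ t. For each S either |N(S)| ≤ D, or C(|N(S)|,ℓ)/C(D,ℓ) ≤ C(|N(S)|,t)/C(D,t);
-- summing, C(D,t)·#K_{ℓ,ℓ} ≤ C(D,ℓ)·(C(D,t)·C(κ,ℓ) + #K_{ℓ,t}). Counting the same pairs from
-- the other side, #K_{ℓ,t} = #K_{t,ℓ} ≤ C(κ,t)·C(t−1,ℓ), because no t-set has t common
-- neighbours; for κ − ℓ = D + ℓb with b ≈ κ/16t this is at most C(κ,ℓ)·C(D,t), whence
-- #K_{ℓ,ℓ} ≤ 2·C(κ,ℓ)·C(D,ℓ). Finally, with q = ℓb and r + 1 = ⌊κ/ℓ⌋,
-- C(κ−ℓ,ℓ) = C(D+q,ℓ) ≥ ((r+1)/r)^q·C(D,ℓ), and ((r+1)/r)^q = (1 − 1/(r+1))^{−q} ≥ e^{q/(r+1)},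
-- where q/(r+1) ≥ ℓ²/16t.

module Binomial where

  open import Data.Nat
  open import Data.Nat.Properties
  open import Data.Nat.Combinatorics using (_C_; nCk+nC[k+1]≡[n+1]C[k+1])
  open import Data.Nat.Tactic.RingSolver using (solve-∀)
  open import Relation.Binary.PropositionalEquality

  -- Binomial coefficients by Pascal's rule, so that they compute by pattern matching.
  choose : ℕ → ℕ → ℕ
  choose n zero = 1
  choose zero (suc k) = 0
  choose (suc n) (suc k) = choose n k + choose n (suc k)

  choose≡C : ∀ n k → choose n k ≡ n C k
  choose≡C zero zero = refl
  choose≡C (suc n) zero = refl
  choose≡C zero (suc k) = refl
  choose≡C (suc n) (suc k) =
    trans (cong₂ _+_ (choose≡C n k) (choose≡C n (suc k))) (nCk+nC[k+1]≡[n+1]C[k+1] n k)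

  n<k⇒choose≡0 : ∀ {n k} → n < k → choose n k ≡ 0
  n<k⇒choose≡0 {zero} {suc k} _ = refl
  n<k⇒choose≡0 {suc n} {suc k} (s≤s n<k)
    rewrite n<k⇒choose≡0 n<k | n<k⇒choose≡0 (m<n⇒m<1+n n<k) = refl

  choose-diag : ∀ n → choose n n ≡ 1
  choose-diag zero = refl
  choose-diag (suc n) rewrite choose-diag n | n<k⇒choose≡0 (n<1+n n) = refl

  choose-pos : ∀ {n k} → k ≤ n → 0 < choose n k
  choose-pos {n} {zero} _ = s≤s z≤n
  choose-pos {suc n} {suc k} (s≤s k≤n) = <-≤-trans (choose-pos k≤n) (m≤m+n _ _)

  choose-1 : ∀ n → choose n 1 ≡ n
  choose-1 zero = refl
  choose-1 (suc n) = cong suc (choose-1 n)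

  choose-≤-suc : ∀ n k → choose n k ≤ choose (suc n) k
  choose-≤-suc n zero = ≤-refl
  choose-≤-suc n (suc k) = m≤n+m _ _

  choose-monoˡ : ∀ {n m} k → n ≤ m → choose n k ≤ choose m k
  choose-monoˡ {n} k n≤m = go (≤⇒≤′ n≤m)
    where
    go : ∀ {m} → n ≤′ m → choose n k ≤ choose m k
    go ≤′-refl = ≤-refl
    go (≤′-step n≤′m) = ≤-trans (go n≤′m) (choose-≤-suc _ k)

  -- (k+1)·C(n,k+1) = (n−k)·C(n,k), with the subtraction moved to the other side.
  choose-ratio-k : ∀ n k → suc k * choose n (suc k) + k * choose n k ≡ n * choose n k
  choose-ratio-k zero zero = refl
  choose-ratio-k zero (suc k) = cong₂ _+_ (*-zeroʳ (suc (suc k))) (*-zeroʳ (suc k))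
  choose-ratio-k (suc n) zero = begin
    choose n 0 + choose n 1 + 0 + 0 ≡⟨ +-identityʳ _ ⟩
    suc (choose n 1) + 0            ≡⟨ +-identityʳ _ ⟩
    suc (choose n 1)                ≡⟨ cong suc (choose-1 n) ⟩
    suc n                           ≡⟨ *-identityʳ (suc n) ⟨
    suc n * 1                       ∎
    where open ≡-Reasoning
  choose-ratio-k (suc n) (suc k) = begin
    suc (suc k) * (B + C) + suc k * (A + B)
      ≡⟨ regroup k A B C ⟩
    (suc (suc k) * C + suc k * B) + (suc k * B + k * A) + B + A
      ≡⟨ cong₂ (λ x y → x + y + B + A) (choose-ratio-k n (suc k)) (choose-ratio-k n k) ⟩
    n * B + n * A + B + A
      ≡⟨ collect n A B ⟩
    suc n * (A + B) ∎
    where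
    open ≡-Reasoning
    A B C : ℕ
    A = choose n k
    B = choose n (suc k)
    C = choose n (suc (suc k))
    regroup : ∀ k A B C → suc (suc k) * (B + C) + suc k * (A + B)
            ≡ (suc (suc k) * C + suc k * B) + (suc k * B + k * A) + B + A
    regroup = solve-∀
    collect : ∀ n A B → n * B + n * A + B + A ≡ suc n * (A + B)
    collect = solve-∀

  choose-absorption : ∀ n k → suc k * choose (suc n) (suc k) ≡ suc n * choose n k
  choose-absorption n k =
    trans (expand k (choose n k) (choose n (suc k))) (cong (choose n k +_) (choose-ratio-k n k))
    where
    expand : ∀ k A B → suc k * (A + B) ≡ A + (suc k * B + k * A)
    expand = solve-∀

  -- (n+1−l)·C(n+1,l) = (n+1)·C(n,l), with the subtraction moved to the other side.
  choose-ratio-n : ∀ n l → suc n * choose n l + l * choose (suc n) l ≡ suc n * choose (suc n) l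
  choose-ratio-n n zero = +-identityʳ _
  choose-ratio-n n (suc k) = begin
    suc n * choose n (suc k) + suc k * choose (suc n) (suc k)
      ≡⟨ cong (suc n * choose n (suc k) +_) (choose-absorption n k) ⟩
    suc n * choose n (suc k) + suc n * choose n k
      ≡⟨ +-comm (suc n * choose n (suc k)) (suc n * choose n k) ⟩
    suc n * choose n k + suc n * choose n (suc k)
      ≡⟨ *-distribˡ-+ (suc n) (choose n k) (choose n (suc k)) ⟨
    suc n * choose (suc n) (suc k) ∎
    where open ≡-Reasoning

  choose-subset-of-subset : ∀ a b c →
    choose (a + b + c) (a + b) * choose (a + b) a ≡ choose (a + b + c) a * choose (b + c) b
  choose-subset-of-subset zero b c = trans (*-identityʳ _) (sym (+-identityʳ _))
  choose-subset-of-subset (suc a) b c = *-cancelˡ-≡ _ _ (suc a * suc (a + b)) (begin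
    suc a * suc (a + b) * (X * Y)
      ≡⟨ swap₁ a b X Y ⟩
    (suc (a + b) * X) * (suc a * Y)
      ≡⟨ cong₂ _*_ (choose-absorption N (a + b)) (choose-absorption (a + b) a) ⟩
    (suc N * choose N (a + b)) * (suc (a + b) * choose (a + b) a)
      ≡⟨ swap₂ N (a + b) (choose N (a + b)) (choose (a + b) a) ⟩
    suc N * suc (a + b) * (choose N (a + b) * choose (a + b) a)
      ≡⟨ cong (suc N * suc (a + b) *_) (choose-subset-of-subset a b c) ⟩
    suc N * suc (a + b) * (choose N a * W)
      ≡⟨ swap₃ N (a + b) (choose N a) W ⟩
    suc (a + b) * ((suc N * choose N a) * W)
      ≡⟨ cong (λ z → suc (a + b) * (z * W)) (choose-absorption N a) ⟨
    suc (a + b) * ((suc a * Z) * W)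
      ≡⟨ swap₄ a (a + b) Z W ⟩
    suc a * suc (a + b) * (Z * W) ∎)
    where
    open ≡-Reasoning
    N X Y Z W : ℕ
    N = a + b + c
    X = choose (suc N) (suc (a + b))
    Y = choose (suc (a + b)) (suc a)
    Z = choose (suc N) (suc a)
    W = choose (b + c) b
    swap₁ : ∀ a b X Y → suc a * suc (a + b) * (X * Y) ≡ (suc (a + b) * X) * (suc a * Y)
    swap₁ = solve-∀
    swap₂ : ∀ N m P Q → (suc N * P) * (suc m * Q) ≡ suc N * suc m * (P * Q)
    swap₂ = solve-∀
    swap₃ : ∀ N m P Q → suc N * suc m * (P * Q) ≡ suc m * ((suc N * P) * Q)
    swap₃ = solve-∀
    swap₄ : ∀ a m Z W → suc m * ((suc a * Z) * W) ≡ suc a * suc m * (Z * W)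
    swap₄ = solve-∀

  choose-shift-bound : ∀ N b k → choose (N + b) (suc k) ≤ choose N (suc k) + b * choose (N + b) k
  choose-shift-bound N zero k rewrite +-identityʳ N = m≤m+n _ _
  choose-shift-bound N (suc b) k rewrite +-suc N b = begin
    choose (N + b) k + choose (N + b) (suc k)
      ≤⟨ +-monoʳ-≤ (choose (N + b) k) (choose-shift-bound N b k) ⟩
    choose (N + b) k + (choose N (suc k) + b * choose (N + b) k)
      ≤⟨ +-mono-≤ grow (+-monoʳ-≤ (choose N (suc k)) (*-monoʳ-≤ b grow)) ⟩
    X + (choose N (suc k) + b * X)
      ≡⟨ regroup X (choose N (suc k)) b ⟩
    choose N (suc k) + suc b * X ∎
    where
    open ≤-Reasoning
    X : ℕ
    X = choose (suc (N + b)) k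
    grow : choose (N + b) k ≤ X
    grow = choose-≤-suc (N + b) k
    regroup : ∀ X Z b → X + (Z + b * X) ≡ Z + suc b * X
    regroup = solve-∀

  choose-lower-top : ∀ N b k → suc b * suc k + k ≤ N + b → choose (N + b) k ≤ choose N (suc k)
  choose-lower-top N b k large = *-cancelˡ-≤ (suc k) (+-cancelʳ-≤ _ _ _ (begin
    suc k * X + (suc k * (b * X) + k * X)
      ≡⟨ expand b k X ⟨
    (suc b * suc k + k) * X
      ≤⟨ *-monoˡ-≤ X large ⟩
    (N + b) * X
      ≡⟨ choose-ratio-k (N + b) k ⟨
    suc k * choose (N + b) (suc k) + k * X
      ≤⟨ +-monoˡ-≤ (k * X) (*-monoʳ-≤ (suc k) (choose-shift-bound N b k)) ⟩
    suc k * (Z + b * X) + k * X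
      ≡⟨ distrib b k Z X ⟩
    suc k * Z + (suc k * (b * X) + k * X) ∎))
    where
    open ≤-Reasoning
    X Z : ℕ
    X = choose (N + b) k
    Z = choose N (suc k)
    expand : ∀ b k X → (suc b * suc k + k) * X ≡ suc k * X + (suc k * (b * X) + k * X)
    expand = solve-∀
    distrib : ∀ b k Z X → suc k * (Z + b * X) + k * X ≡ suc k * Z + (suc k * (b * X) + k * X)
    distrib = solve-∀

  choose-trade : ∀ D b j k → suc b * (k + j) + (k + j) ≤ D + suc b →
    choose (D + j * b) k ≤ choose D (k + j)
  choose-trade D b zero k _ rewrite +-identityʳ D | +-identityʳ k = ≤-refl
  choose-trade D b (suc j) k large = begin
    choose (D + (b + j * b)) k
      ≡⟨ cong (λ z → choose z k) (reassoc D b (j * b)) ⟩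
    choose (D + j * b + b) k
      ≤⟨ choose-lower-top (D + j * b) b k step-large ⟩
    choose (D + j * b) (suc k)
      ≤⟨ choose-trade D b j (suc k) (subst (λ z → suc b * z + z ≤ D + suc b) (+-suc k j) large) ⟩
    choose D (suc k + j)
      ≡⟨ cong (choose D) (+-suc k j) ⟨
    choose D (k + suc j) ∎
    where
    open ≤-Reasoning
    reassoc : ∀ D b c → D + (b + c) ≡ D + c + b
    reassoc = solve-∀
    sk≤k+sj : suc k ≤ k + suc j
    sk≤k+sj = subst (suc k ≤_) (sym (+-suc k j)) (s≤s (m≤m+n k j))
    step-large : suc b * suc k + k ≤ D + j * b + b
    step-large = ≤-trans (s≤s⁻¹ (begin
      suc (suc b * suc k + k)               ≡⟨ +-suc (suc b * suc k) k ⟨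
      suc b * suc k + suc k                 ≤⟨ +-mono-≤ (*-monoʳ-≤ (suc b) sk≤k+sj) sk≤k+sj ⟩
      suc b * (k + suc j) + (k + suc j)     ≤⟨ large ⟩
      D + suc b                             ≡⟨ +-suc D b ⟩
      suc (D + b)                           ∎))
      (+-monoˡ-≤ b (m≤m+n D (j * b)))

  -- C(n+1,l)/C(n,l) = (n+1)/(n+1−l) ≥ (r+1)/r as long as n+1 ≤ (r+1)·l.
  choose-growth-step : ∀ n l r → suc n ≤ suc r * l → choose n l * suc r ≤ choose (suc n) l * r
  choose-growth-step n l r small = *-cancelˡ-≤ (suc n) (+-cancelʳ-≤ _ _ _ (begin
    suc n * (U * suc r) + (l * V) * suc r
      ≡⟨ factor n U V r l ⟩
    (suc n * U + l * V) * suc r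
      ≡⟨ cong (_* suc r) (choose-ratio-n n l) ⟩
    (suc n * V) * suc r
      ≡⟨ expand n V r ⟩
    suc n * (V * r) + suc n * V
      ≤⟨ +-monoʳ-≤ (suc n * (V * r)) (*-monoˡ-≤ V small) ⟩
    suc n * (V * r) + (suc r * l) * V
      ≡⟨ reorder n V r l ⟩
    suc n * (V * r) + (l * V) * suc r ∎))
    where
    open ≤-Reasoning
    U V : ℕ
    U = choose n l
    V = choose (suc n) l
    factor : ∀ n U V r l → suc n * (U * suc r) + (l * V) * suc r ≡ (suc n * U + l * V) * suc r
    factor = solve-∀
    expand : ∀ n V r → (suc n * V) * suc r ≡ suc n * (V * r) + suc n * V
    expand = solve-∀
    reorder : ∀ n V r l → suc n * (V * r) + (suc r * l) * V ≡ suc n * (V * r) + (l * V) * suc r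
    reorder = solve-∀

  choose-growth : ∀ l r q D → D + q ≤ suc r * l → choose D l * suc r ^ q ≤ choose (D + q) l * r ^ q
  choose-growth l r zero D _ rewrite +-identityʳ D = ≤-refl
  choose-growth l r (suc q) D small = begin
    choose D l * (suc r * suc r ^ q)
      ≡⟨ *-assoc (choose D l) (suc r) _ ⟨
    (choose D l * suc r) * suc r ^ q
      ≤⟨ *-monoˡ-≤ (suc r ^ q) (choose-growth-step D l r (≤-trans (s≤s (m≤m+n D q)) small′)) ⟩
    (choose (suc D) l * r) * suc r ^ q
      ≡⟨ reorder (choose (suc D) l) r (suc r ^ q) ⟩
    r * (choose (suc D) l * suc r ^ q)
      ≤⟨ *-monoʳ-≤ r (choose-growth l r q (suc D) small′) ⟩
    r * (choose (suc D + q) l * r ^ q)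
      ≡⟨ reorder′ (choose (suc D + q) l) r (r ^ q) ⟩
    choose (suc D + q) l * (r * r ^ q)
      ≡⟨ cong (λ z → choose z l * (r * r ^ q)) (+-suc D q) ⟨
    choose (D + suc q) l * (r * r ^ q) ∎
    where
    open ≤-Reasoning
    small′ : suc D + q ≤ suc r * l
    small′ = subst (_≤ suc r * l) (+-suc D q) small
    reorder : ∀ A r B → (A * r) * B ≡ r * (A * B)
    reorder = solve-∀
    reorder′ : ∀ A r B → r * (A * B) ≡ A * (r * B)
    reorder′ = solve-∀

  -- For ℓ ≤ t ≤ D ≤ d:  C(d,ℓ)/C(D,ℓ) ≤ C(d,t)/C(D,t), via the subset-of-a-subset identity.
  choose-cross-mono : ∀ l u v w →
    choose (l + u + v + w) l * choose (l + u + v) (l + u) ≤ choose (l + u + v) l * choose (l + u + v + w) (l + u)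
  choose-cross-mono l u v w = *-cancelʳ-≤ _ _ (choose t l) {{>-nonZero (choose-pos (m≤m+n l u))}} (begin
    choose d l * choose D t * choose t l
      ≡⟨ *-assoc (choose d l) _ _ ⟩
    choose d l * (choose D t * choose t l)
      ≡⟨ cong (choose d l *_) (choose-subset-of-subset l u v) ⟩
    choose d l * (choose D l * choose (u + v) u)
      ≤⟨ *-monoʳ-≤ (choose d l) (*-monoʳ-≤ (choose D l) (choose-monoˡ u u+v≤u+v+w)) ⟩
    choose d l * (choose D l * choose (u + (v + w)) u)
      ≡⟨ swap (choose d l) (choose D l) _ ⟩
    choose D l * (choose d l * choose (u + (v + w)) u)
      ≡⟨ cong (choose D l *_) (sym trinomial) ⟩
    choose D l * (choose d t * choose t l)
      ≡⟨ *-assoc (choose D l) _ _ ⟨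
    choose D l * choose d t * choose t l ∎)
    where
    open ≤-Reasoning
    t D d : ℕ
    t = l + u
    D = l + u + v
    d = D + w
    u+v≤u+v+w : u + v ≤ u + (v + w)
    u+v≤u+v+w = +-monoʳ-≤ u (m≤m+n v w)
    trinomial : choose d t * choose t l ≡ choose d l * choose (u + (v + w)) u
    trinomial = subst (λ z → choose z t * choose t l ≡ choose z l * choose (u + (v + w)) u)
      (sym (+-assoc t v w)) (choose-subset-of-subset l u (v + w))
    swap : ∀ A B C → A * (B * C) ≡ B * (A * C)
    swap = solve-∀

  choose-diagonal-step : ∀ p k → choose (p + k) k * suc p ≤ choose (p + suc k) (suc k) * suc k
  choose-diagonal-step p k = begin
    choose (p + k) k * suc p               ≡⟨ *-comm (choose (p + k) k) (suc p) ⟩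
    suc p * choose (p + k) k               ≤⟨ *-monoˡ-≤ (choose (p + k) k) (s≤s (m≤m+n p k)) ⟩
    suc (p + k) * choose (p + k) k         ≡⟨ choose-absorption (p + k) k ⟨
    suc k * choose (suc (p + k)) (suc k)   ≡⟨ *-comm (suc k) _ ⟩
    choose (suc (p + k)) (suc k) * suc k   ≡⟨ cong (λ n → choose n (suc k) * suc k) (+-suc p k) ⟨
    choose (p + suc k) (suc k) * suc k     ∎
    where open ≤-Reasoning

module Sums where

  open import Data.Bool using (Bool; true; false; _∧_)
  open import Data.Nat
  open import Data.Nat.Properties
  open import Data.Nat.Tactic.RingSolver using (solve-∀)
  open import Data.List using (List; []; _∷_; map; _++_; length; filterᵇ; cartesianProduct)
  open import Data.Product using (_×_; _,_)
  open import Function using (_∘_)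
  open import Relation.Binary.PropositionalEquality

  𝟙 : Bool → ℕ
  𝟙 true = 1
  𝟙 false = 0

  𝟙-∧ : ∀ a b → 𝟙 (a ∧ b) ≡ 𝟙 a * 𝟙 b
  𝟙-∧ true b = sym (+-identityʳ (𝟙 b))
  𝟙-∧ false b = refl

  sumBy : {A : Set} → (A → ℕ) → List A → ℕ
  sumBy f [] = 0
  sumBy f (x ∷ xs) = f x + sumBy f xs

  module _ {A : Set} where

    length-filterᵇ : ∀ (p : A → Bool) xs → length (filterᵇ p xs) ≡ sumBy (𝟙 ∘ p) xs
    length-filterᵇ p [] = refl
    length-filterᵇ p (x ∷ xs) with p x
    ... | true = cong suc (length-filterᵇ p xs)
    ... | false = length-filterᵇ p xs

    sumBy-++ : ∀ (f : A → ℕ) xs ys → sumBy f (xs ++ ys) ≡ sumBy f xs + sumBy f ys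
    sumBy-++ f [] ys = refl
    sumBy-++ f (x ∷ xs) ys = trans (cong (f x +_) (sumBy-++ f xs ys)) (sym (+-assoc (f x) _ _))

    sumBy-cong : ∀ {f g : A → ℕ} xs → (∀ x → f x ≡ g x) → sumBy f xs ≡ sumBy g xs
    sumBy-cong [] e = refl
    sumBy-cong (x ∷ xs) e = cong₂ _+_ (e x) (sumBy-cong xs e)

    sumBy-mono : ∀ {f g : A → ℕ} xs → (∀ x → f x ≤ g x) → sumBy f xs ≤ sumBy g xs
    sumBy-mono [] e = z≤n
    sumBy-mono (x ∷ xs) e = +-mono-≤ (e x) (sumBy-mono xs e)

    sumBy-zero : ∀ {f : A → ℕ} xs → (∀ x → f x ≡ 0) → sumBy f xs ≡ 0
    sumBy-zero [] e = refl
    sumBy-zero (x ∷ xs) e = cong₂ _+_ (e x) (sumBy-zero xs e)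

    sumBy-*ˡ : ∀ c (f : A → ℕ) xs → sumBy (λ x → c * f x) xs ≡ c * sumBy f xs
    sumBy-*ˡ c f [] = sym (*-zeroʳ c)
    sumBy-*ˡ c f (x ∷ xs) = trans (cong (c * f x +_) (sumBy-*ˡ c f xs)) (sym (*-distribˡ-+ c (f x) _))

    sumBy-+ : ∀ (f g : A → ℕ) xs → sumBy (λ x → f x + g x) xs ≡ sumBy f xs + sumBy g xs
    sumBy-+ f g [] = refl
    sumBy-+ f g (x ∷ xs) = trans (cong (f x + g x +_) (sumBy-+ f g xs)) (interchange (f x) (g x) _ _)
      where
      interchange : ∀ a b c d → a + b + (c + d) ≡ a + c + (b + d)
      interchange = solve-∀

  sumBy-map : ∀ {A B : Set} (f : B → ℕ) (g : A → B) xs → sumBy f (map g xs) ≡ sumBy (f ∘ g) xs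
  sumBy-map f g [] = refl
  sumBy-map f g (x ∷ xs) = cong (f (g x) +_) (sumBy-map f g xs)

  sumBy-cartesianProduct : ∀ {A B : Set} (f : A × B → ℕ) xs ys →
    sumBy f (cartesianProduct xs ys) ≡ sumBy (λ x → sumBy (λ y → f (x , y)) ys) xs
  sumBy-cartesianProduct f [] ys = refl
  sumBy-cartesianProduct f (x ∷ xs) ys = trans (sumBy-++ f (map (x ,_) ys) _)
    (cong₂ _+_ (sumBy-map f (x ,_) ys) (sumBy-cartesianProduct f xs ys))

  sumBy-swap : ∀ {A B : Set} (f : A → B → ℕ) xs ys →
    sumBy (λ x → sumBy (f x) ys) xs ≡ sumBy (λ y → sumBy (λ x → f x y) xs) ys
  sumBy-swap f [] ys = sym (sumBy-zero ys (λ _ → refl))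
  sumBy-swap f (x ∷ xs) ys = trans (cong (sumBy (f x) ys +_) (sumBy-swap f xs ys))
    (sym (sumBy-+ (f x) (λ y → sumBy (λ x → f x y) xs) ys))

module Biclique where

  open import Defs hiding (sym)
  open Binomial
  open Sums
  open import Data.Bool using (Bool; true; false; _∧_; _∨_; not; T)
  open import Data.Bool.Properties using (T-∧; ∧-zeroʳ; ∧-identityʳ)
  open import Data.Nat
  open import Data.Nat.Properties
  open import Data.Fin using (Fin; zero; suc)
  open import Data.Fin.Subset using (Subset; _∈_; ∣_∣) renaming (⊤ to full)
  open import Data.Fin.Subset.Properties using (∣⊤∣≡n)
  open import Data.Vec using ([]; _∷_; here; there; tabulate)
  open import Data.List using ([]; _∷_; map; allFin; cartesianProduct)
  open import Data.List.Membership.Propositional using () renaming (_∈_ to _∈ˡ_)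
  open import Data.List.Membership.Propositional.Properties using (∈-allFin)
  open import Data.List.Relation.Unary.Any using (here; there)
  open import Data.Product using (Σ; _×_; _,_; proj₁; proj₂)
  open import Data.Unit using (tt)
  open import Data.Empty using (⊥-elim)
  open import Function using (_∘_; Equivalence; case_of_)
  open import Relation.Nullary using (¬_)
  open import Relation.Nullary.Decidable using (toWitness; fromWitness)
  open import Relation.Binary.PropositionalEquality

  open Equivalence using (to; from)

  T-ext : ∀ {a b} → (T a → T b) → (T b → T a) → a ≡ b
  T-ext {true} {true} _ _ = refl
  T-ext {true} {false} f _ = ⊥-elim (f tt)
  T-ext {false} {true} _ g = ⊥-elim (g tt)
  T-ext {false} {false} _ _ = refl

  T-not∨⁺ : ∀ {a b} → (T a → T b) → T (not a ∨ b)
  T-not∨⁺ {true} f = f tt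
  T-not∨⁺ {false} _ = tt

  T-not∨⁻ : ∀ {a b} → T (not a ∨ b) → T a → T b
  T-not∨⁻ {true} p _ = p

  ==⇒≡ : ∀ {m n} → T (m == n) → m ≡ n
  ==⇒≡ = toWitness

  ≡⇒== : ∀ {m n} → m ≡ n → T (m == n)
  ≡⇒== = fromWitness

  ==-suc : ∀ m n → (suc m == suc n) ≡ (m == n)
  ==-suc m n = T-ext (λ p → ≡⇒== (suc-injective (==⇒≡ p))) (λ p → ≡⇒== (cong suc (==⇒≡ p)))

  suc==zero : ∀ m → (suc m == 0) ≡ false
  suc==zero m = T-ext (λ p → case ==⇒≡ {suc m} {0} p of λ ()) (λ ())

  allᵇ⁺ : ∀ {A : Set} (p : A → Bool) xs → (∀ x → T (p x)) → T (allᵇ p xs)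
  allᵇ⁺ p [] _ = tt
  allᵇ⁺ p (x ∷ xs) h = from T-∧ (h x , allᵇ⁺ p xs h)

  allᵇ⁻ : ∀ {A : Set} (p : A → Bool) xs → T (allᵇ p xs) → ∀ x → x ∈ˡ xs → T (p x)
  allᵇ⁻ p (y ∷ xs) h x (here refl) = proj₁ (to T-∧ h)
  allᵇ⁻ p (y ∷ xs) h x (there x∈xs) = allᵇ⁻ p xs (proj₂ (to (T-∧ {p y}) h)) x x∈xs

  allᵇ-allFin⁻ : ∀ {n} (p : Fin n → Bool) → T (allᵇ p (allFin n)) → ∀ i → T (p i)
  allᵇ-allFin⁻ p h i = allᵇ⁻ p _ h i (∈-allFin i)

  memᵇ-tabulate : ∀ {n} (f : Fin n → Bool) i → memᵇ i (tabulate f) ≡ f i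
  memᵇ-tabulate f zero = refl
  memᵇ-tabulate f (suc i) = memᵇ-tabulate (f ∘ suc) i

  ∈⇒memᵇ : ∀ {n} {i : Fin n} {S : Subset n} → i ∈ S → T (memᵇ i S)
  ∈⇒memᵇ here = tt
  ∈⇒memᵇ (there i∈S) = ∈⇒memᵇ i∈S

  _⊆ᵇ_ : ∀ {n} → Subset n → Subset n → Bool
  [] ⊆ᵇ [] = true
  (u ∷ U) ⊆ᵇ (w ∷ W) = (not u ∨ w) ∧ (U ⊆ᵇ W)

  ⊆ᵇ⁺ : ∀ {n} (U W : Subset n) → (∀ i → T (memᵇ i U) → T (memᵇ i W)) → T (U ⊆ᵇ W)
  ⊆ᵇ⁺ [] [] _ = tt
  ⊆ᵇ⁺ (u ∷ U) (w ∷ W) h = from T-∧ (T-not∨⁺ (h zero) , ⊆ᵇ⁺ U W (h ∘ suc))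

  ⊆ᵇ⁻ : ∀ {n} (U W : Subset n) → T (U ⊆ᵇ W) → ∀ i → T (memᵇ i U) → T (memᵇ i W)
  ⊆ᵇ⁻ (u ∷ U) (w ∷ W) h zero = T-not∨⁻ {u} (proj₁ (to T-∧ h))
  ⊆ᵇ⁻ (u ∷ U) (w ∷ W) h (suc i) = ⊆ᵇ⁻ U W (proj₂ (to (T-∧ {not u ∨ w}) h)) i

  ⊆ᵇ-full : ∀ {n} (U : Subset n) → (U ⊆ᵇ full) ≡ true
  ⊆ᵇ-full [] = refl
  ⊆ᵇ-full (true ∷ U) = ⊆ᵇ-full U
  ⊆ᵇ-full (false ∷ U) = ⊆ᵇ-full U

  subset-of-size : ∀ {n} (W : Subset n) k → k ≤ ∣ W ∣ → Σ (Subset n) λ U → (∣ U ∣ ≡ k) × T (U ⊆ᵇ W)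
  subset-of-size [] zero _ = [] , refl , tt
  subset-of-size (w ∷ W) zero _ with subset-of-size W zero z≤n
  ... | U , ∣U∣ , U⊆W = false ∷ U , ∣U∣ , from T-∧ (tt , U⊆W)
  subset-of-size (true ∷ W) (suc k) (s≤s k≤∣W∣) with subset-of-size W k k≤∣W∣
  ... | U , ∣U∣ , U⊆W = true ∷ U , cong suc ∣U∣ , from T-∧ (tt , U⊆W)
  subset-of-size (false ∷ W) (suc k) k≤∣W∣ with subset-of-size W (suc k) k≤∣W∣
  ... | U , ∣U∣ , U⊆W = false ∷ U , ∣U∣ , from T-∧ (tt , U⊆W)

  sumBy-allSubsets-suc : ∀ n (f : Subset (suc n) → ℕ) →
    sumBy f (allSubsets (suc n)) ≡ sumBy (f ∘ (true ∷_)) (allSubsets n) + sumBy (f ∘ (false ∷_)) (allSubsets n)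
  sumBy-allSubsets-suc n f = trans (sumBy-++ f (map (true ∷_) (allSubsets n)) _)
    (cong₂ _+_ (sumBy-map f (true ∷_) (allSubsets n)) (sumBy-map f (false ∷_) (allSubsets n)))

  count-subsets-of-size : ∀ n (W : Subset n) k →
    sumBy (λ U → 𝟙 ((∣ U ∣ == k) ∧ (U ⊆ᵇ W))) (allSubsets n) ≡ choose (∣ W ∣) k
  count-subsets-of-size zero [] zero = refl
  count-subsets-of-size zero [] (suc k) = refl
  count-subsets-of-size (suc n) (w ∷ W) k = begin
    sumBy f (allSubsets (suc n))
      ≡⟨ sumBy-allSubsets-suc n f ⟩
    sumBy (f ∘ (true ∷_)) (allSubsets n) + sumBy (f ∘ (false ∷_)) (allSubsets n)
      ≡⟨ cong (sumBy (f ∘ (true ∷_)) (allSubsets n) +_) (count-subsets-of-size n W k) ⟩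
    sumBy (f ∘ (true ∷_)) (allSubsets n) + choose (∣ W ∣) k
      ≡⟨ with-head w k ⟩
    choose (∣ w ∷ W ∣) k ∎
    where
    open ≡-Reasoning
    f : Subset (suc n) → ℕ
    f U = 𝟙 ((∣ U ∣ == k) ∧ (U ⊆ᵇ (w ∷ W)))
    with-head : ∀ w k → sumBy (λ U → 𝟙 ((∣ true ∷ U ∣ == k) ∧ ((not true ∨ w) ∧ (U ⊆ᵇ W)))) (allSubsets n)
                          + choose (∣ W ∣) k ≡ choose (∣ w ∷ W ∣) k
    with-head false k =
      cong (_+ choose (∣ W ∣) k) (sumBy-zero (allSubsets n) (λ U → cong 𝟙 (∧-zeroʳ (∣ true ∷ U ∣ == k))))
    with-head true zero =
      cong (_+ 1) (sumBy-zero (allSubsets n) (λ U → cong (λ b → 𝟙 (b ∧ (U ⊆ᵇ W))) (suc==zero ∣ U ∣)))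
    with-head true (suc k) = cong (_+ choose (∣ W ∣) (suc k))
      (trans (sumBy-cong (allSubsets n) (λ U → cong (λ b → 𝟙 (b ∧ (U ⊆ᵇ W))) (==-suc ∣ U ∣ k)))
             (count-subsets-of-size n W k))

  count-subsets : ∀ n k → sumBy (λ S → 𝟙 (∣ S ∣ == k)) (allSubsets n) ≡ choose n k
  count-subsets n k = begin
    sumBy (λ S → 𝟙 (∣ S ∣ == k)) (allSubsets n)
      ≡⟨ sumBy-cong (allSubsets n) (λ S → cong 𝟙 (sym (within-full S))) ⟩
    sumBy (λ S → 𝟙 ((∣ S ∣ == k) ∧ (S ⊆ᵇ full))) (allSubsets n)
      ≡⟨ count-subsets-of-size n full k ⟩
    choose (∣ full {n} ∣) k
      ≡⟨ cong (λ m → choose m k) (∣⊤∣≡n n) ⟩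
    choose n k ∎
    where
    open ≡-Reasoning
    within-full : ∀ S → ((∣ S ∣ == k) ∧ (S ⊆ᵇ full)) ≡ (∣ S ∣ == k)
    within-full S = trans (cong ((∣ S ∣ == k) ∧_) (⊆ᵇ-full S)) (∧-identityʳ _)

  module _ {κ} (H : Graph κ) where

    commonNbhd : Subset κ → Subset κ
    commonNbhd S = tabulate (λ j → allᵇ (λ i → not (memᵇ i S) ∨ adj H i j) (allFin κ))

    Complete : Subset κ → Subset κ → Set
    Complete S U = ∀ i j → T (memᵇ i S) → T (memᵇ j U) → Adj H i j

    Complete-sym : ∀ S U → Complete S U → Complete U S
    Complete-sym S U c i j i∈U j∈S = subst T (Graph.sym H j i) (c j i j∈S i∈U)

    ⊆ᵇcommonNbhd⇒Complete : ∀ S U → T (U ⊆ᵇ commonNbhd S) → Complete S U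
    ⊆ᵇcommonNbhd⇒Complete S U U⊆N i j i∈S j∈U =
      T-not∨⁻ (allᵇ-allFin⁻ _ (subst T (memᵇ-tabulate _ j) (⊆ᵇ⁻ U (commonNbhd S) U⊆N j j∈U)) i) i∈S

    Complete⇒⊆ᵇcommonNbhd : ∀ S U → Complete S U → T (U ⊆ᵇ commonNbhd S)
    Complete⇒⊆ᵇcommonNbhd S U c = ⊆ᵇ⁺ U (commonNbhd S) λ j j∈U →
      subst T (sym (memᵇ-tabulate _ j)) (allᵇ⁺ _ (allFin κ) λ i → T-not∨⁺ λ i∈S → c i j i∈S j∈U)

    ⊆ᵇcommonNbhd-comm : ∀ S U → (U ⊆ᵇ commonNbhd S) ≡ (S ⊆ᵇ commonNbhd U)
    ⊆ᵇcommonNbhd-comm S U = T-ext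
      (λ U⊆N → Complete⇒⊆ᵇcommonNbhd U S (Complete-sym S U (⊆ᵇcommonNbhd⇒Complete S U U⊆N)))
      (λ S⊆N → Complete⇒⊆ᵇcommonNbhd S U (Complete-sym U S (⊆ᵇcommonNbhd⇒Complete U S S⊆N)))

    isCopyᵇ-commonNbhd : ∀ ℓ S U →
      isCopyᵇ H ℓ S U ≡ (∣ S ∣ == ℓ) ∧ ((∣ U ∣ == ℓ) ∧ (U ⊆ᵇ commonNbhd S))
    isCopyᵇ-commonNbhd ℓ S U = cong (λ b → (∣ S ∣ == ℓ) ∧ ((∣ U ∣ == ℓ) ∧ b)) (T-ext
      (λ h → Complete⇒⊆ᵇcommonNbhd S U λ i j i∈S j∈U →
        T-not∨⁻ (allᵇ-allFin⁻ _ (allᵇ-allFin⁻ _ h i) j) (from T-∧ (i∈S , j∈U)))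
      (λ U⊆N → allᵇ⁺ _ (allFin κ) λ i → allᵇ⁺ _ (allFin κ) λ j → T-not∨⁺ λ i∈S∧j∈U →
        let (i∈S , j∈U) = to T-∧ i∈S∧j∈U in ⊆ᵇcommonNbhd⇒Complete S U U⊆N i j i∈S j∈U))

    commonNbhd-small : ∀ t → ¬ ContainsK H t → ∀ A → ∣ A ∣ ≡ t → ∣ commonNbhd A ∣ < t
    commonNbhd-small t noK A ∣A∣ = ≰⇒> λ t≤∣N∣ → case subset-of-size (commonNbhd A) t t≤∣N∣ of λ where
      (U , ∣U∣ , U⊆N) → noK (A , U , ∣A∣ , ∣U∣ , λ i j i∈A j∈U →
        ⊆ᵇcommonNbhd⇒Complete A U U⊆N i j (∈⇒memᵇ i∈A) (∈⇒memᵇ j∈U))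

  bicliqueCount : ∀ {κ} → Graph κ → ℕ → ℕ → ℕ
  bicliqueCount {κ} H a b = sumBy (λ S → 𝟙 (∣ S ∣ == a) * choose (∣ commonNbhd H S ∣) b) (allSubsets κ)

  module _ {κ} (H : Graph κ) where

    private
      pairs : ℕ → ℕ → Subset κ → Subset κ → ℕ
      pairs a b S U = 𝟙 (∣ S ∣ == a) * 𝟙 ((∣ U ∣ == b) ∧ (U ⊆ᵇ commonNbhd H S))

      bicliqueCount-pairs : ∀ a b →
        bicliqueCount H a b ≡ sumBy (λ S → sumBy (pairs a b S) (allSubsets κ)) (allSubsets κ)
      bicliqueCount-pairs a b = sumBy-cong (allSubsets κ) λ S → sym (begin
        sumBy (pairs a b S) (allSubsets κ)
          ≡⟨ sumBy-*ˡ (𝟙 (∣ S ∣ == a)) _ (allSubsets κ) ⟩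
        𝟙 (∣ S ∣ == a) * sumBy (λ U → 𝟙 ((∣ U ∣ == b) ∧ (U ⊆ᵇ commonNbhd H S))) (allSubsets κ)
          ≡⟨ cong (𝟙 (∣ S ∣ == a) *_) (count-subsets-of-size κ (commonNbhd H S) b) ⟩
        𝟙 (∣ S ∣ == a) * choose (∣ commonNbhd H S ∣) b ∎)
        where open ≡-Reasoning

      pairs-swap : ∀ a b S U → pairs a b S U ≡ pairs b a U S
      pairs-swap a b S U = begin
        𝟙 (∣ S ∣ == a) * 𝟙 ((∣ U ∣ == b) ∧ (U ⊆ᵇ commonNbhd H S))
          ≡⟨ cong (𝟙 (∣ S ∣ == a) *_) (𝟙-∧ (∣ U ∣ == b) _) ⟩
        𝟙 (∣ S ∣ == a) * (𝟙 (∣ U ∣ == b) * 𝟙 (U ⊆ᵇ commonNbhd H S))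
          ≡⟨ *-assoc (𝟙 (∣ S ∣ == a)) _ _ ⟨
        𝟙 (∣ S ∣ == a) * 𝟙 (∣ U ∣ == b) * 𝟙 (U ⊆ᵇ commonNbhd H S)
          ≡⟨ cong₂ (λ x y → x * 𝟙 y) (*-comm (𝟙 (∣ S ∣ == a)) _) (⊆ᵇcommonNbhd-comm H S U) ⟩
        𝟙 (∣ U ∣ == b) * 𝟙 (∣ S ∣ == a) * 𝟙 (S ⊆ᵇ commonNbhd H U)
          ≡⟨ *-assoc (𝟙 (∣ U ∣ == b)) _ _ ⟩
        𝟙 (∣ U ∣ == b) * (𝟙 (∣ S ∣ == a) * 𝟙 (S ⊆ᵇ commonNbhd H U))
          ≡⟨ cong (𝟙 (∣ U ∣ == b) *_) (𝟙-∧ (∣ S ∣ == a) _) ⟨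
        𝟙 (∣ U ∣ == b) * 𝟙 ((∣ S ∣ == a) ∧ (S ⊆ᵇ commonNbhd H U)) ∎
        where open ≡-Reasoning

    copies≡bicliqueCount : ∀ ℓ → copies H ℓ ≡ bicliqueCount H ℓ ℓ
    copies≡bicliqueCount ℓ = begin
      copies H ℓ
        ≡⟨ length-filterᵇ _ (cartesianProduct (allSubsets κ) (allSubsets κ)) ⟩
      sumBy (λ p → 𝟙 (isCopyᵇ H ℓ (proj₁ p) (proj₂ p))) (cartesianProduct (allSubsets κ) (allSubsets κ))
        ≡⟨ sumBy-cartesianProduct _ (allSubsets κ) (allSubsets κ) ⟩
      sumBy (λ S → sumBy (λ U → 𝟙 (isCopyᵇ H ℓ S U)) (allSubsets κ)) (allSubsets κ)
        ≡⟨ sumBy-cong (allSubsets κ) (λ S → sumBy-cong (allSubsets κ) λ U →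
             trans (cong 𝟙 (isCopyᵇ-commonNbhd H ℓ S U)) (𝟙-∧ (∣ S ∣ == ℓ) _)) ⟩
      sumBy (λ S → sumBy (pairs ℓ ℓ S) (allSubsets κ)) (allSubsets κ)
        ≡⟨ bicliqueCount-pairs ℓ ℓ ⟨
      bicliqueCount H ℓ ℓ ∎
      where open ≡-Reasoning

    bicliqueCount-comm : ∀ a b → bicliqueCount H a b ≡ bicliqueCount H b a
    bicliqueCount-comm a b = begin
      bicliqueCount H a b
        ≡⟨ bicliqueCount-pairs a b ⟩
      sumBy (λ S → sumBy (pairs a b S) (allSubsets κ)) (allSubsets κ)
        ≡⟨ sumBy-swap (pairs a b) (allSubsets κ) (allSubsets κ) ⟩
      sumBy (λ U → sumBy (λ S → pairs a b S U) (allSubsets κ)) (allSubsets κ)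
        ≡⟨ sumBy-cong (allSubsets κ) (λ U → sumBy-cong (allSubsets κ) λ S → pairs-swap a b S U) ⟩
      sumBy (λ U → sumBy (pairs b a U) (allSubsets κ)) (allSubsets κ)
        ≡⟨ bicliqueCount-pairs b a ⟨
      bicliqueCount H b a ∎
      where open ≡-Reasoning

    bicliqueCount-≤ : ∀ t ℓ → ¬ ContainsK H t → bicliqueCount H t ℓ ≤ choose κ t * choose (pred t) ℓ
    bicliqueCount-≤ t ℓ noK = begin
      bicliqueCount H t ℓ
        ≤⟨ sumBy-mono (allSubsets κ) bound ⟩
      sumBy (λ A → choose (pred t) ℓ * 𝟙 (∣ A ∣ == t)) (allSubsets κ)
        ≡⟨ sumBy-*ˡ (choose (pred t) ℓ) _ (allSubsets κ) ⟩
      choose (pred t) ℓ * sumBy (λ A → 𝟙 (∣ A ∣ == t)) (allSubsets κ)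
        ≡⟨ cong (choose (pred t) ℓ *_) (count-subsets κ t) ⟩
      choose (pred t) ℓ * choose κ t
        ≡⟨ *-comm (choose (pred t) ℓ) (choose κ t) ⟩
      choose κ t * choose (pred t) ℓ ∎
      where
      open ≤-Reasoning
      bound : ∀ A → 𝟙 (∣ A ∣ == t) * choose (∣ commonNbhd H A ∣) ℓ ≤ choose (pred t) ℓ * 𝟙 (∣ A ∣ == t)
      bound A with ∣ A ∣ == t in ∣A∣==t
      ... | false = z≤n
      ... | true = begin
        choose (∣ commonNbhd H A ∣) ℓ + 0
          ≡⟨ +-identityʳ _ ⟩
        choose (∣ commonNbhd H A ∣) ℓ
          ≤⟨ choose-monoˡ ℓ (∸-monoˡ-≤ 1 (commonNbhd-small H t noK A (==⇒≡ (subst T (sym ∣A∣==t) tt)))) ⟩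
        choose (pred t) ℓ
          ≡⟨ *-identityʳ _ ⟨
        choose (pred t) ℓ * 1 ∎

module CopiesBound where

  open import Defs hiding (sym)
  open Binomial
  open Sums
  open Biclique
  open import Data.Nat
  open import Data.Nat.Properties
  open import Data.Nat.Tactic.RingSolver using (solve-∀)
  open import Data.Fin.Subset using (Subset; ∣_∣)
  open import Data.List using (List)
  open import Data.Product using (_,_)
  open import Data.Sum using (inj₁; inj₂)
  open import Relation.Nullary using (¬_)
  open import Relation.Binary.PropositionalEquality

  choose-split-bound : ∀ l u v d →
    choose d l * choose (l + u + v) (l + u) ≤ choose (l + u + v) l * (choose (l + u + v) (l + u) + choose d (l + u))
  choose-split-bound l u v d with ≤-total d (l + u + v)
  ... | inj₁ d≤D = *-mono-≤ (choose-monoˡ l d≤D) (m≤m+n _ _)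
  ... | inj₂ D≤d with m≤n⇒∃[o]m+o≡n D≤d
  ...   | w , refl = ≤-trans (choose-cross-mono l u v w) (*-monoʳ-≤ (choose (l + u + v) l) (m≤n+m _ _))

  module _ {κ} (H : Graph κ) (ℓ u v : ℕ) where

    private
      t D : ℕ
      t = ℓ + u
      D = ℓ + u + v

    bicliqueCount-weighted :
      choose D t * bicliqueCount H ℓ ℓ ≤ choose D ℓ * (choose D t * choose κ ℓ + bicliqueCount H ℓ t)
    bicliqueCount-weighted = begin
      choose D t * sumBy f all
        ≡⟨ sumBy-*ˡ (choose D t) f all ⟨
      sumBy (λ S → choose D t * f S) all
        ≤⟨ sumBy-mono all bound ⟩
      sumBy (λ S → choose D ℓ * (choose D t * 𝟙 (∣ S ∣ == ℓ) + g S)) all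
        ≡⟨ sumBy-*ˡ (choose D ℓ) _ all ⟩
      choose D ℓ * sumBy (λ S → choose D t * 𝟙 (∣ S ∣ == ℓ) + g S) all
        ≡⟨ cong (choose D ℓ *_) (sumBy-+ _ g all) ⟩
      choose D ℓ * (sumBy (λ S → choose D t * 𝟙 (∣ S ∣ == ℓ)) all + sumBy g all)
        ≡⟨ cong (λ n → choose D ℓ * (n + sumBy g all)) (sumBy-*ˡ (choose D t) _ all) ⟩
      choose D ℓ * (choose D t * sumBy (λ S → 𝟙 (∣ S ∣ == ℓ)) all + sumBy g all)
        ≡⟨ cong (λ n → choose D ℓ * (choose D t * n + sumBy g all)) (count-subsets κ ℓ) ⟩
      choose D ℓ * (choose D t * choose κ ℓ + bicliqueCount H ℓ t) ∎
      where
      open ≤-Reasoning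
      all : List (Subset κ)
      all = allSubsets κ
      f g : Subset κ → ℕ
      f S = 𝟙 (∣ S ∣ == ℓ) * choose (∣ commonNbhd H S ∣) ℓ
      g S = 𝟙 (∣ S ∣ == ℓ) * choose (∣ commonNbhd H S ∣) t
      bound : ∀ S → choose D t * f S ≤ choose D ℓ * (choose D t * 𝟙 (∣ S ∣ == ℓ) + g S)
      bound S = begin
        choose D t * (i * X)
          ≡⟨ reorder (choose D t) i X ⟩
        i * (X * choose D t)
          ≤⟨ *-monoʳ-≤ i (choose-split-bound ℓ u v (∣ commonNbhd H S ∣)) ⟩
        i * (choose D ℓ * (choose D t + choose (∣ commonNbhd H S ∣) t))
          ≡⟨ distribute i (choose D ℓ) (choose D t) (choose (∣ commonNbhd H S ∣) t) ⟩
        choose D ℓ * (choose D t * i + i * choose (∣ commonNbhd H S ∣) t) ∎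
        where
        i X : ℕ
        i = 𝟙 (∣ S ∣ == ℓ)
        X = choose (∣ commonNbhd H S ∣) ℓ
        reorder : ∀ d i X → d * (i * X) ≡ i * (X * d)
        reorder = solve-∀
        distribute : ∀ i a d e → i * (a * (d + e)) ≡ a * (d * i + i * e)
        distribute = solve-∀

  -- C(κ,t)·C(t,ℓ) = C(κ,ℓ)·C(κ−ℓ,t−ℓ), and κ − ℓ = D + ℓb lets C(κ−ℓ,t−ℓ) trade down to C(D,t).
  choose-t-sets-bound : ∀ κ ℓ u v b → κ ≡ ℓ + (ℓ + u + v + ℓ * b) →
    suc b * (u + ℓ) + (u + ℓ) ≤ ℓ + u + v + suc b →
    choose κ (ℓ + u) * choose (pred (ℓ + u)) ℓ ≤ choose κ ℓ * choose (ℓ + u + v) (ℓ + u)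
  choose-t-sets-bound κ ℓ u v b refl large = begin
    choose κ t * choose (pred t) ℓ
      ≤⟨ *-monoʳ-≤ (choose κ t) (choose-monoˡ ℓ pred[n]≤n) ⟩
    choose κ t * choose t ℓ
      ≡⟨ subst (λ K → choose K t * choose t ℓ ≡ choose K ℓ * choose (u + c) u) (sym κ≡)
           (choose-subset-of-subset ℓ u c) ⟩
    choose κ ℓ * choose (u + c) u
      ≡⟨ cong (λ n → choose κ ℓ * choose n u) (u+c≡ ℓ u v (ℓ * b)) ⟩
    choose κ ℓ * choose (D + ℓ * b) u
      ≤⟨ *-monoʳ-≤ (choose κ ℓ) (choose-trade D b ℓ u large) ⟩
    choose κ ℓ * choose D (u + ℓ)
      ≡⟨ cong (λ k → choose κ ℓ * choose D k) (+-comm u ℓ) ⟩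
    choose κ ℓ * choose D t ∎
    where
    open ≤-Reasoning
    t D c : ℕ
    t = ℓ + u
    D = ℓ + u + v
    c = ℓ + v + ℓ * b
    κ≡ : κ ≡ ℓ + u + c
    κ≡ = κ≡′ ℓ u v (ℓ * b)
      where
      κ≡′ : ∀ l u v w → l + (l + u + v + w) ≡ l + u + (l + v + w)
      κ≡′ = solve-∀
    u+c≡ : ∀ l u v w → u + (l + v + w) ≡ l + u + v + w
    u+c≡ = solve-∀

  copies-≤ : ∀ {κ} (H : Graph κ) ℓ u v b → ¬ ContainsK H (ℓ + u) →
    κ ≡ ℓ + (ℓ + u + v + ℓ * b) →
    suc b * (u + ℓ) + (u + ℓ) ≤ ℓ + u + v + suc b →
    copies H ℓ ≤ 2 * choose κ ℓ * choose (ℓ + u + v) ℓ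
  copies-≤ {κ} H ℓ u v b noK κ≡ large =
    *-cancelˡ-≤ (choose D t) {{>-nonZero (choose-pos (m≤m+n t v))}} (begin
      choose D t * copies H ℓ
        ≡⟨ cong (choose D t *_) (copies≡bicliqueCount H ℓ) ⟩
      choose D t * bicliqueCount H ℓ ℓ
        ≤⟨ bicliqueCount-weighted H ℓ u v ⟩
      choose D ℓ * (choose D t * choose κ ℓ + bicliqueCount H ℓ t)
        ≡⟨ cong (λ n → choose D ℓ * (choose D t * choose κ ℓ + n)) (bicliqueCount-comm H ℓ t) ⟩
      choose D ℓ * (choose D t * choose κ ℓ + bicliqueCount H t ℓ)
        ≤⟨ *-monoʳ-≤ (choose D ℓ) (+-monoʳ-≤ (choose D t * choose κ ℓ) (begin
             bicliqueCount H t ℓ              ≤⟨ bicliqueCount-≤ H t ℓ noK ⟩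
             choose κ t * choose (pred t) ℓ   ≤⟨ choose-t-sets-bound κ ℓ u v b κ≡ large ⟩
             choose κ ℓ * choose D t          ≡⟨ *-comm (choose κ ℓ) (choose D t) ⟩
             choose D t * choose κ ℓ          ∎)) ⟩
      choose D ℓ * (choose D t * choose κ ℓ + choose D t * choose κ ℓ)
        ≡⟨ rearrange (choose D ℓ) (choose D t) (choose κ ℓ) ⟩
      choose D t * (2 * choose κ ℓ * choose D ℓ) ∎)
    where
    open ≤-Reasoning
    t D : ℕ
    t = ℓ + u
    D = ℓ + u + v
    rearrange : ∀ a d k → a * (d * k + d * k) ≡ d * (2 * k * a)
    rearrange = solve-∀

module Rationals where

  open import Data.Nat as ℕ using (ℕ; zero; suc)
  import Data.Nat.Properties as ℕ
  open import Data.Integer as ℤ using (ℤ; +_)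
  import Data.Integer.Properties as ℤ
  open import Data.Integer.Tactic.RingSolver using () renaming (solve-∀ to ℤ-solve-∀)
  open import Data.Rational
  open import Data.Rational.Properties
  import Data.Rational.Unnormalised as ℚᵘ
  import Data.Rational.Unnormalised.Properties as ℚᵘ
  open import Relation.Binary.PropositionalEquality
  open import Algebra.Bundles using (CommutativeMonoid)

  fromℕ : ℕ → ℚ
  fromℕ n = + n / 1

  private
    toℚᵘ-/ : ∀ a d → toℚᵘ (+ a / suc d) ℚᵘ.≃ ℚᵘ.mkℚᵘ (+ a) d
    toℚᵘ-/ a d = toℚᵘ-fromℚᵘ (ℚᵘ.mkℚᵘ (+ a) d)

  /-+ : ∀ a c d → + a / suc d + + c / suc d ≡ + (a ℕ.+ c) / suc d
  /-+ a c d = toℚᵘ-injective (ℚᵘ.≃-trans (toℚᵘ-homo-+ (+ a / suc d) (+ c / suc d))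
    (ℚᵘ.≃-trans (ℚᵘ.+-cong (toℚᵘ-/ a d) (toℚᵘ-/ c d))
    (ℚᵘ.≃-trans (ℚᵘ.*≡* cross) (ℚᵘ.≃-sym (toℚᵘ-/ (a ℕ.+ c) d)))))
    where
    factor : ∀ (A C S : ℤ) → (A ℤ.* S ℤ.+ C ℤ.* S) ℤ.* S ≡ (A ℤ.+ C) ℤ.* (S ℤ.* S)
    factor = ℤ-solve-∀
    cross : (+ a ℤ.* + suc d ℤ.+ + c ℤ.* + suc d) ℤ.* + suc d ≡ + (a ℕ.+ c) ℤ.* (+ suc d ℤ.* + suc d)
    cross = trans (factor (+ a) (+ c) (+ suc d)) (cong (ℤ._* (+ suc d ℤ.* + suc d)) (sym (ℤ.pos-+ a c)))

  fromℕ-*-/ : ∀ a c d → fromℕ a * (+ c / suc d) ≡ + (a ℕ.* c) / suc d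
  fromℕ-*-/ a c d = toℚᵘ-injective (ℚᵘ.≃-trans (toℚᵘ-homo-* (fromℕ a) (+ c / suc d))
    (ℚᵘ.≃-trans (ℚᵘ.*-cong (toℚᵘ-/ a 0) (toℚᵘ-/ c d))
    (ℚᵘ.≃-trans (ℚᵘ.*≡* cross) (ℚᵘ.≃-sym (toℚᵘ-/ (a ℕ.* c) d)))))
    where
    cross : (+ a ℤ.* + c) ℤ.* + suc d ≡ + (a ℕ.* c) ℤ.* + (1 ℕ.* suc d)
    cross = trans (cong (ℤ._* + suc d) (sym (ℤ.pos-* a c)))
                  (cong (λ z → + (a ℕ.* c) ℤ.* + z) (sym (ℕ.*-identityˡ (suc d))))

  fromℕ-+ : ∀ a c → fromℕ (a ℕ.+ c) ≡ fromℕ a + fromℕ c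
  fromℕ-+ a c = sym (/-+ a c 0)

  fromℕ-* : ∀ a c → fromℕ (a ℕ.* c) ≡ fromℕ a * fromℕ c
  fromℕ-* a c = sym (fromℕ-*-/ a c 0)

  /-≡ : ∀ a d c e → a ℕ.* suc e ≡ c ℕ.* suc d → + a / suc d ≡ + c / suc e
  /-≡ a d c e h = fromℚᵘ-cong {ℚᵘ.mkℚᵘ (+ a) d} {ℚᵘ.mkℚᵘ (+ c) e}
    (ℚᵘ.*≡* (trans (sym (ℤ.pos-* a (suc e))) (trans (cong +_ h) (ℤ.pos-* c (suc d)))))

  /-≤ : ∀ a d c e → a ℕ.* suc e ℕ.≤ c ℕ.* suc d → + a / suc d ≤ + c / suc e
  /-≤ a d c e h = toℚᵘ-cancel-≤
    (ℚᵘ.≤-respˡ-≃ (ℚᵘ.≃-sym (toℚᵘ-/ a d)) (ℚᵘ.≤-respʳ-≃ (ℚᵘ.≃-sym (toℚᵘ-/ c e))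
    (ℚᵘ.*≤* (subst₂ ℤ._≤_ (ℤ.pos-* a (suc e)) (ℤ.pos-* c (suc d)) (ℤ.+≤+ h)))))

  /-nonNeg : ∀ a d → 0ℚ ≤ + a / suc d
  /-nonNeg a d = /-≤ 0 0 a d ℕ.z≤n

  fromℕ-mono-≤ : ∀ {a c} → a ℕ.≤ c → fromℕ a ≤ fromℕ c
  fromℕ-mono-≤ {a} {c} a≤c = /-≤ a 0 c 0 (subst₂ ℕ._≤_ (sym (ℕ.*-identityʳ a)) (sym (ℕ.*-identityʳ c)) a≤c)

  fromℕ-nonNeg : ∀ n → 0ℚ ≤ fromℕ n
  fromℕ-nonNeg n = /-nonNeg n 0

  fromℕ-pos : ∀ {n} → 0 ℕ.< n → Positive (fromℕ n)
  fromℕ-pos {suc n} _ = normalize-pos (suc n) 1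

  *-nonNeg : ∀ {a b} → 0ℚ ≤ a → 0ℚ ≤ b → 0ℚ ≤ a * b
  *-nonNeg {a} {b} 0≤a 0≤b = nonNegative⁻¹ _ {{nonNeg*nonNeg⇒nonNeg a {{nonNegative 0≤a}} b {{nonNegative 0≤b}}}}

  +-nonNeg : ∀ {a b} → 0ℚ ≤ a → 0ℚ ≤ b → 0ℚ ≤ a + b
  +-nonNeg {a} {b} 0≤a 0≤b = nonNegative⁻¹ _ {{nonNeg+nonNeg⇒nonNeg a {{nonNegative 0≤a}} b {{nonNegative 0≤b}}}}

  *-mono-≤-nonNeg : ∀ {a b c d} → 0ℚ ≤ a → 0ℚ ≤ c → a ≤ b → c ≤ d → a * c ≤ b * d
  *-mono-≤-nonNeg {a} {b} {c} {d} 0≤a 0≤c a≤b c≤d =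
    ≤-trans (*-monoʳ-≤-nonNeg c {{nonNegative 0≤c}} a≤b) (*-monoˡ-≤-nonNeg b {{nonNegative (≤-trans 0≤a a≤b)}} c≤d)

  p≤p+q : ∀ {p q} → 0ℚ ≤ q → p ≤ p + q
  p≤p+q {p} {q} 0≤q = subst (_≤ p + q) (+-identityʳ p) (+-monoʳ-≤ p 0≤q)

  +-cancelʳ-≤ : ∀ {a b c} → a + c ≤ b + c → a ≤ b
  +-cancelʳ-≤ {a} {b} {c} h = subst₂ _≤_ (cancel a) (cancel b) (+-monoˡ-≤ (- c) h)
    where
    cancel : ∀ a → a + c + - c ≡ a
    cancel a = trans (+-assoc a c (- c)) (trans (cong (λ v → a + v) (+-inverseʳ c)) (+-identityʳ a))

  pow : ℚ → ℕ → ℚ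
  pow x zero = 1ℚ
  pow x (suc k) = x * pow x k

  pow-nonNeg : ∀ {y} → 0ℚ ≤ y → ∀ k → 0ℚ ≤ pow y k
  pow-nonNeg 0≤y zero = fromℕ-nonNeg 1
  pow-nonNeg 0≤y (suc k) = *-nonNeg 0≤y (pow-nonNeg 0≤y k)

  pow-* : ∀ a c q → pow (a * c) q ≡ pow a q * pow c q
  pow-* a c zero = sym (*-identityˡ 1ℚ)
  pow-* a c (suc q) = begin
    a * c * pow (a * c) q     ≡⟨ cong (a * c *_) (pow-* a c q) ⟩
    a * c * (pow a q * pow c q) ≡⟨ *-assoc a c _ ⟩
    a * (c * (pow a q * pow c q)) ≡⟨ cong (a *_) (x∙yz≈y∙xz c (pow a q) (pow c q)) ⟩
    a * (pow a q * (c * pow c q)) ≡⟨ *-assoc a (pow a q) _ ⟨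
    a * pow a q * (c * pow c q) ∎
    where
    open ≡-Reasoning
    open import Algebra.Properties.CommutativeSemigroup
      (CommutativeMonoid.commutativeSemigroup *-1-commutativeMonoid) using (x∙yz≈y∙xz)

  fromℕ-^ : ∀ a q → fromℕ (a ℕ.^ q) ≡ pow (fromℕ a) q
  fromℕ-^ a zero = refl
  fromℕ-^ a (suc q) = trans (fromℕ-* a (a ℕ.^ q)) (cong (fromℕ a *_) (fromℕ-^ a q))

module Exponential where

  open import Defs using (expTerm; expPartial)
  open Binomial
  open Rationals
  open import Data.Nat as ℕ using (ℕ; zero; suc)
  import Data.Nat.Properties as ℕ
  open import Data.Integer using (+_)
  open import Data.Rational
  open import Data.Rational.Properties
  open import Data.Rational.Solver using (module +-*-Solver)
  open +-*-Solver using (solve; _:+_; _:*_; _:=_; con)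
  open import Relation.Binary.PropositionalEquality

  expTerm-nonNeg : ∀ {x} → 0ℚ ≤ x → ∀ k → 0ℚ ≤ expTerm x k
  expTerm-nonNeg 0≤x zero = fromℕ-nonNeg 1
  expTerm-nonNeg 0≤x (suc k) = *-nonNeg (*-nonNeg (expTerm-nonNeg 0≤x k) 0≤x) (/-nonNeg 1 k)

  expPartial-nonNeg : ∀ {x} → 0ℚ ≤ x → ∀ n → 0ℚ ≤ expPartial x n
  expPartial-nonNeg 0≤x zero = fromℕ-nonNeg 1
  expPartial-nonNeg 0≤x (suc n) = +-nonNeg (expPartial-nonNeg 0≤x n) (expTerm-nonNeg 0≤x (suc n))

  -- (1 − y)^{−q} = Σ_k C(q−1+k, k) y^k; negBinomial q n is its partial sum up to k = n.
  module _ (y : ℚ) (0≤y : 0ℚ ≤ y) where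

    negBinomialTerm : ℕ → ℕ → ℚ
    negBinomialTerm p k = fromℕ (choose (p ℕ.+ k) k) * pow y k

    negBinomial′ : ℕ → ℕ → ℚ
    negBinomial′ p zero = negBinomialTerm p zero
    negBinomial′ p (suc n) = negBinomial′ p n + negBinomialTerm p (suc n)

    negBinomial : ℕ → ℕ → ℚ
    negBinomial zero n = 1ℚ
    negBinomial (suc p) n = negBinomial′ p n

    negBinomialTerm-nonNeg : ∀ p k → 0ℚ ≤ negBinomialTerm p k
    negBinomialTerm-nonNeg p k = *-nonNeg (fromℕ-nonNeg (choose (p ℕ.+ k) k)) (pow-nonNeg 0≤y k)

    negBinomial-mono : ∀ q n → negBinomial q n ≤ negBinomial q (suc n)
    negBinomial-mono zero n = ≤-refl
    negBinomial-mono (suc p) n = p≤p+q (negBinomialTerm-nonNeg p (suc n))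

    negBinomial-0 : ∀ q → negBinomial q 0 ≡ 1ℚ
    negBinomial-0 zero = refl
    negBinomial-0 (suc p) = *-identityˡ 1ℚ

    private
      negBinomial′-0-suc : ∀ n → negBinomial′ 0 (suc n) ≡ 1ℚ + y * negBinomial′ 0 n
      negBinomial′-0-suc zero =
        solve 1 (λ y → con 1ℚ :* con 1ℚ :+ con 1ℚ :* (y :* con 1ℚ) := con 1ℚ :+ y :* (con 1ℚ :* con 1ℚ)) refl y
      negBinomial′-0-suc (suc n) = begin
        negBinomial′ 0 (suc n) + fromℕ (choose (suc (suc n)) (suc (suc n))) * (y * P)
          ≡⟨ cong₂ (λ a c → a + fromℕ c * (y * P)) (negBinomial′-0-suc n) (choose-diag (suc (suc n))) ⟩
        (1ℚ + y * negBinomial′ 0 n) + 1ℚ * (y * P)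
          ≡⟨ solve 3 (λ y a t → (con 1ℚ :+ y :* a) :+ con 1ℚ :* (y :* t) := con 1ℚ :+ y :* (a :+ con 1ℚ :* t))
                   refl y (negBinomial′ 0 n) P ⟩
        1ℚ + y * (negBinomial′ 0 n + 1ℚ * P)
          ≡⟨ cong (λ c → 1ℚ + y * (negBinomial′ 0 n + fromℕ c * P)) (sym (choose-diag (suc n))) ⟩
        1ℚ + y * (negBinomial′ 0 n + fromℕ (choose (suc n) (suc n)) * P) ∎
        where
        open ≡-Reasoning
        P : ℚ
        P = pow y (suc n)

      negBinomial′-suc-suc : ∀ p n →
        negBinomial′ (suc p) (suc n) ≡ negBinomial′ p (suc n) + y * negBinomial′ (suc p) n
      negBinomial′-suc-suc p zero = begin
        fromℕ 1 * 1ℚ + fromℕ (1 ℕ.+ choose (p ℕ.+ 1) 1) * (y * 1ℚ)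
          ≡⟨ cong (λ v → fromℕ 1 * 1ℚ + v * (y * 1ℚ)) (fromℕ-+ 1 (choose (p ℕ.+ 1) 1)) ⟩
        1ℚ * 1ℚ + (1ℚ + X) * (y * 1ℚ)
          ≡⟨ solve 2 (λ y X → con 1ℚ :* con 1ℚ :+ (con 1ℚ :+ X) :* (y :* con 1ℚ)
                           := (con 1ℚ :* con 1ℚ :+ X :* (y :* con 1ℚ)) :+ y :* (con 1ℚ :* con 1ℚ)) refl y X ⟩
        (1ℚ * 1ℚ + X * (y * 1ℚ)) + y * (1ℚ * 1ℚ) ∎
        where
        open ≡-Reasoning
        X : ℚ
        X = fromℕ (choose (p ℕ.+ 1) 1)
      negBinomial′-suc-suc p (suc n) = begin
        negBinomial′ (suc p) (suc n) + fromℕ (choose (p ℕ.+ n₂) n₁ ℕ.+ choose (p ℕ.+ n₂) n₂) * (y * P)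
          ≡⟨ cong₂ (λ a c → a + c * (y * P)) (negBinomial′-suc-suc p n) (fromℕ-+ (choose (p ℕ.+ n₂) n₁) _) ⟩
        (negBinomial′ p n₁ + y * negBinomial′ (suc p) n) + (X + Y) * (y * P)
          ≡⟨ solve 6 (λ y a b X Y P → (a :+ y :* b) :+ (X :+ Y) :* (y :* P) := (a :+ Y :* (y :* P)) :+ y :* (b :+ X :* P))
                   refl y (negBinomial′ p n₁) (negBinomial′ (suc p) n) X Y P ⟩
        (negBinomial′ p n₁ + Y * (y * P)) + y * (negBinomial′ (suc p) n + X * P)
          ≡⟨ cong (λ v → (negBinomial′ p n₁ + Y * (y * P)) + y * (negBinomial′ (suc p) n + fromℕ (choose v n₁) * P))
                  (ℕ.+-suc p n₁) ⟩
        (negBinomial′ p n₁ + Y * (y * P)) + y * (negBinomial′ (suc p) n + fromℕ (choose (suc (p ℕ.+ n₁)) n₁) * P) ∎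
        where
        open ≡-Reasoning
        n₁ n₂ : ℕ
        n₁ = suc n
        n₂ = suc n₁
        P X Y : ℚ
        P = pow y n₁
        X = fromℕ (choose (p ℕ.+ n₂) n₁)
        Y = fromℕ (choose (p ℕ.+ n₂) n₂)

    negBinomial-pascal : ∀ q n → negBinomial (suc q) (suc n) ≡ negBinomial q (suc n) + y * negBinomial (suc q) n
    negBinomial-pascal zero n = negBinomial′-0-suc n
    negBinomial-pascal (suc p) n = negBinomial′-suc-suc p n

    module _ (z : ℚ) (0≤z : 0ℚ ≤ z) (z+y≡1 : z + y ≡ 1ℚ) where

      *-negBinomial-suc : ∀ q n → z * negBinomial (suc q) n ≤ negBinomial q n
      *-negBinomial-suc q zero rewrite negBinomial-0 q | negBinomial-0 (suc q) = begin
        z * 1ℚ ≡⟨ *-identityʳ z ⟩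
        z      ≤⟨ p≤p+q 0≤y ⟩
        z + y  ≡⟨ z+y≡1 ⟩
        1ℚ     ∎
        where open ≤-Reasoning
      *-negBinomial-suc q (suc n) = +-cancelʳ-≤ (begin
        z * X + y * X                      ≡⟨ *-distribʳ-+ X z y ⟨
        (z + y) * X                        ≡⟨ cong (_* X) z+y≡1 ⟩
        1ℚ * X                             ≡⟨ *-identityˡ X ⟩
        X                                  ≡⟨ negBinomial-pascal q n ⟩
        negBinomial q (suc n) + y * negBinomial (suc q) n
          ≤⟨ +-monoʳ-≤ (negBinomial q (suc n)) (*-monoˡ-≤-nonNeg y {{nonNegative 0≤y}} (negBinomial-mono (suc q) n)) ⟩
        negBinomial q (suc n) + y * X      ∎)
        where
        open ≤-Reasoning
        X : ℚ
        X = negBinomial (suc q) (suc n)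

      pow-*-negBinomial : ∀ q n → pow z q * negBinomial q n ≤ 1ℚ
      pow-*-negBinomial zero n = ≤-reflexive (*-identityˡ 1ℚ)
      pow-*-negBinomial (suc q) n = begin
        (z * pow z q) * negBinomial (suc q) n
          ≡⟨ solve 3 (λ z w b → (z :* w) :* b := w :* (z :* b)) refl z (pow z q) (negBinomial (suc q) n) ⟩
        pow z q * (z * negBinomial (suc q) n)
          ≤⟨ *-monoˡ-≤-nonNeg (pow z q) {{nonNegative (pow-nonNeg 0≤z q)}} (*-negBinomial-suc q n) ⟩
        pow z q * negBinomial q n
          ≤⟨ pow-*-negBinomial q n ⟩
        1ℚ ∎
        where open ≤-Reasoning

    module _ (x : ℚ) (p : ℕ) (0≤x : 0ℚ ≤ x) (x≤[1+p]y : x ≤ fromℕ (suc p) * y) where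

      expTerm≤negBinomialTerm : ∀ k → expTerm x k ≤ negBinomialTerm p k
      expTerm≤negBinomialTerm zero = ≤-reflexive (sym (*-identityˡ 1ℚ))
      expTerm≤negBinomialTerm (suc k) = begin
        expTerm x k * x * (+ 1 / suc k)
          ≤⟨ *-monoʳ-≤-nonNeg (+ 1 / suc k) {{nonNegative (/-nonNeg 1 k)}}
               (*-mono-≤-nonNeg (expTerm-nonNeg 0≤x k) 0≤x (expTerm≤negBinomialTerm k) x≤[1+p]y) ⟩
        negBinomialTerm p k * (fromℕ (suc p) * y) * (+ 1 / suc k)
          ≡⟨ solve 5 (λ c w e y q → c :* w :* (e :* y) :* q := (c :* e :* q) :* (y :* w)) refl
               (fromℕ (choose (p ℕ.+ k) k)) (pow y k) (fromℕ (suc p)) y (+ 1 / suc k) ⟩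
        (fromℕ (choose (p ℕ.+ k) k) * fromℕ (suc p) * (+ 1 / suc k)) * pow y (suc k)
          ≡⟨ cong (λ v → (v * (+ 1 / suc k)) * pow y (suc k)) (fromℕ-* (choose (p ℕ.+ k) k) (suc p)) ⟨
        (fromℕ m * (+ 1 / suc k)) * pow y (suc k)
          ≡⟨ cong (_* pow y (suc k)) (fromℕ-*-/ m 1 k) ⟩
        (+ (m ℕ.* 1) / suc k) * pow y (suc k)
          ≤⟨ *-monoʳ-≤-nonNeg (pow y (suc k)) {{nonNegative (pow-nonNeg 0≤y (suc k))}}
               (/-≤ (m ℕ.* 1) k (choose (p ℕ.+ suc k) (suc k)) 0 m≤) ⟩
        fromℕ (choose (p ℕ.+ suc k) (suc k)) * pow y (suc k) ∎
        where
        open ≤-Reasoning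
        m : ℕ
        m = choose (p ℕ.+ k) k ℕ.* suc p
        m≤ : m ℕ.* 1 ℕ.* 1 ℕ.≤ choose (p ℕ.+ suc k) (suc k) ℕ.* suc k
        m≤ = subst (ℕ._≤ choose (p ℕ.+ suc k) (suc k) ℕ.* suc k)
               (sym (trans (ℕ.*-identityʳ _) (ℕ.*-identityʳ _))) (choose-diagonal-step p k)

      expPartial≤negBinomial : ∀ n → expPartial x n ≤ negBinomial (suc p) n
      expPartial≤negBinomial zero = expTerm≤negBinomialTerm zero
      expPartial≤negBinomial (suc n) = +-mono-≤ (expPartial≤negBinomial n) (expTerm≤negBinomialTerm (suc n))

  -- e^x ≤ e^{qy} ≤ (1 − y)^{−q}, checked on partial sums.
  expPartial-*-pow≤1 : ∀ (y z x : ℚ) q → 0 ℕ.< q → 0ℚ ≤ y → 0ℚ ≤ z → z + y ≡ 1ℚ →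
    0ℚ ≤ x → x ≤ fromℕ q * y → ∀ n → expPartial x n * pow z q ≤ 1ℚ
  expPartial-*-pow≤1 y z x (suc p) _ 0≤y 0≤z z+y≡1 0≤x x≤qy n = begin
    expPartial x n * pow z (suc p)
      ≤⟨ *-monoʳ-≤-nonNeg (pow z (suc p)) {{nonNegative (pow-nonNeg 0≤z (suc p))}}
           (expPartial≤negBinomial y 0≤y x p 0≤x x≤qy n) ⟩
    negBinomial y 0≤y (suc p) n * pow z (suc p)
      ≡⟨ *-comm (negBinomial y 0≤y (suc p) n) _ ⟩
    pow z (suc p) * negBinomial y 0≤y (suc p) n
      ≤⟨ pow-*-negBinomial y 0≤y z 0≤z z+y≡1 (suc p) n ⟩
    1ℚ ∎
    where open ≤-Reasoning

module Assembly where

  open import Defs hiding (sym)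
  open Binomial
  open CopiesBound
  open Rationals
  open Exponential
  open import Data.Nat using (ℕ; zero; suc; _<_; _≤_; _*_; _∸_; _+_; _^_; z≤n; s≤s; >-nonZero; _/_; _%_)
  open import Data.Nat.Properties
  open import Data.Nat.DivMod using (m/n*n≤m; m≡m%n+[m/n]*n; m%n<n)
  open import Data.Nat.Tactic.RingSolver using (solve-∀)
  open import Data.Integer using (+_)
  import Data.Rational as ℚ
  import Data.Rational.Properties as ℚ
  open import Data.Rational.Solver using (module +-*-Solver)
  open +-*-Solver using (solve; _:+_; _:*_; _:=_; con)
  open import Data.Product using (∃-syntax; _×_; _,_; proj₁; proj₂)
  open import Relation.Nullary using (¬_; contradiction)
  open import Relation.Binary.PropositionalEquality

  absorb-growth : ∀ (a m r q : ℕ) (E : ℚ.ℚ) → 0 < r → ℚ.0ℚ ℚ.≤ E →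
    a * suc r ^ q ≤ m * r ^ q → E ℚ.* pow (+ r ℚ./ suc r) q ℚ.≤ ℚ.1ℚ →
    fromℕ a ℚ.* E ℚ.≤ fromℕ m
  absorb-growth a m r q E 0<r 0≤E growth small =
    ℚ.*-cancelʳ-≤-pos (fromℕ (r ^ q)) {{fromℕ-pos (m^n>0 r {{>-nonZero 0<r}} q)}} (begin
    fromℕ a ℚ.* E ℚ.* fromℕ (r ^ q)
      ≡⟨ cong (fromℕ a ℚ.* E ℚ.*_) (trans (fromℕ-^ r q) (cong (λ w → pow w q) (sym z[r+1]≡r))) ⟩
    fromℕ a ℚ.* E ℚ.* pow (z ℚ.* fromℕ (suc r)) q
      ≡⟨ cong (fromℕ a ℚ.* E ℚ.*_) (pow-* z (fromℕ (suc r)) q) ⟩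
    fromℕ a ℚ.* E ℚ.* (pow z q ℚ.* pow (fromℕ (suc r)) q)
      ≡⟨ solve 4 (λ a e u w → (a :* e) :* (u :* w) := (a :* w) :* (e :* u)) refl (fromℕ a) E (pow z q) _ ⟩
    fromℕ a ℚ.* pow (fromℕ (suc r)) q ℚ.* (E ℚ.* pow z q)
      ≤⟨ ℚ.*-monoˡ-≤-nonNeg (fromℕ a ℚ.* pow (fromℕ (suc r)) q)
           {{ℚ.nonNegative (*-nonNeg (fromℕ-nonNeg a) (pow-nonNeg (fromℕ-nonNeg (suc r)) q))}} small ⟩
    fromℕ a ℚ.* pow (fromℕ (suc r)) q ℚ.* ℚ.1ℚ
      ≡⟨ ℚ.*-identityʳ _ ⟩
    fromℕ a ℚ.* pow (fromℕ (suc r)) q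
      ≡⟨ trans (cong (fromℕ a ℚ.*_) (sym (fromℕ-^ (suc r) q))) (sym (fromℕ-* a (suc r ^ q))) ⟩
    fromℕ (a * suc r ^ q)
      ≤⟨ fromℕ-mono-≤ growth ⟩
    fromℕ (m * r ^ q)
      ≡⟨ fromℕ-* m (r ^ q) ⟩
    fromℕ m ℚ.* fromℕ (r ^ q) ∎)
    where
    open ℚ.≤-Reasoning
    z : ℚ.ℚ
    z = + r ℚ./ suc r
    z[r+1]≡r : z ℚ.* fromℕ (suc r) ≡ fromℕ r
    z[r+1]≡r = trans (ℚ.*-comm z (fromℕ (suc r)))
      (trans (fromℕ-*-/ (suc r) r r) (/-≡ (suc r * r) r r 0 (trans (*-identityʳ _) (*-comm (suc r) r))))

  ratio-nonNeg : ∀ ℓ t → ℚ.0ℚ ℚ.≤ ratio ℓ t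
  ratio-nonNeg ℓ zero = ℚ.≤-refl
  ratio-nonNeg ℓ (suc t′) = /-nonNeg (ℓ * ℓ) _

  ratio-≤ : ∀ ℓ t b r → 0 < t → suc r * ℓ ≤ b * (16 * t) → ratio ℓ t ℚ.≤ fromℕ (ℓ * b) ℚ.* (+ 1 ℚ./ suc r)
  ratio-≤ ℓ (suc t′) b r _ rℓ≤ = subst (ratio ℓ (suc t′) ℚ.≤_) (sym (fromℕ-*-/ (ℓ * b) 1 r))
    (/-≤ (ℓ * ℓ) _ (ℓ * b * 1) r (begin
      ℓ * ℓ * suc r              ≡⟨ reorder ℓ (suc r) ⟩
      ℓ * (suc r * ℓ)            ≤⟨ *-monoʳ-≤ ℓ rℓ≤ ⟩
      ℓ * (b * (16 * suc t′))    ≡⟨ reorder′ ℓ b (16 * suc t′) ⟩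
      ℓ * b * 1 * (16 * suc t′)  ∎))
    where
    open ≤-Reasoning
    reorder : ∀ l r → l * l * r ≡ l * (r * l)
    reorder = solve-∀
    reorder′ : ∀ l b s → l * (b * s) ≡ l * b * 1 * s
    reorder′ = solve-∀

  -- With t = ℓ + u, κ − ℓ is split as D + q where D = ℓ + u + v and q = ℓb;
  -- parameters takes b = ⌊κ/16t⌋ + 1 and r + 1 = ⌊κ/ℓ⌋.
  record Parameters (κ t ℓ : ℕ) : Set where
    field
      u v b r : ℕ
      ℓ+u≡t : ℓ + u ≡ t
      κ≡ : κ ≡ ℓ + (ℓ + u + v + ℓ * b)
      trade : suc b * (u + ℓ) + (u + ℓ) ≤ ℓ + u + v + suc b
      b-pos : 0 < b
      r-pos : 0 < r
      growth : ℓ + u + v + ℓ * b ≤ suc r * ℓ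
      rate : suc r * ℓ ≤ b * (16 * t)

  copies-*-expPartial-≤ : ∀ {κ} (H : Graph κ) t ℓ → 0 < t → 0 < ℓ → ¬ ContainsK H t → Parameters κ t ℓ → ∀ n →
    fromℕ (copies H ℓ) ℚ.* expPartial (ratio ℓ t) n ℚ.≤ fromℕ (2 * (choose κ ℓ * choose (κ ∸ ℓ) ℓ))
  copies-*-expPartial-≤ {κ} H t ℓ 0<t 0<ℓ noK P n = begin
    fromℕ (copies H ℓ) ℚ.* E
      ≤⟨ ℚ.*-monoʳ-≤-nonNeg E {{ℚ.nonNegative 0≤E}} (fromℕ-mono-≤ copies-bound) ⟩
    fromℕ (2 * choose κ ℓ * choose D ℓ) ℚ.* E
      ≡⟨ cong (ℚ._* E) (fromℕ-* (2 * choose κ ℓ) (choose D ℓ)) ⟩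
    fromℕ (2 * choose κ ℓ) ℚ.* fromℕ (choose D ℓ) ℚ.* E
      ≡⟨ ℚ.*-assoc (fromℕ (2 * choose κ ℓ)) _ E ⟩
    fromℕ (2 * choose κ ℓ) ℚ.* (fromℕ (choose D ℓ) ℚ.* E)
      ≤⟨ ℚ.*-monoˡ-≤-nonNeg (fromℕ (2 * choose κ ℓ)) {{ℚ.nonNegative (fromℕ-nonNeg (2 * choose κ ℓ))}}
           (absorb-growth (choose D ℓ) (choose (κ ∸ ℓ) ℓ) r q E r-pos 0≤E choose-bound exp-bound) ⟩
    fromℕ (2 * choose κ ℓ) ℚ.* fromℕ (choose (κ ∸ ℓ) ℓ)
      ≡⟨ trans (sym (fromℕ-* (2 * choose κ ℓ) _)) (cong fromℕ (*-assoc 2 (choose κ ℓ) _)) ⟩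
    fromℕ (2 * (choose κ ℓ * choose (κ ∸ ℓ) ℓ)) ∎
    where
    open ℚ.≤-Reasoning
    open Parameters P
    D q : ℕ
    D = ℓ + u + v
    q = ℓ * b
    E y z : ℚ.ℚ
    E = expPartial (ratio ℓ t) n
    y = + 1 ℚ./ suc r
    z = + r ℚ./ suc r
    0≤x : ℚ.0ℚ ℚ.≤ ratio ℓ t
    0≤x = ratio-nonNeg ℓ t
    0≤E : ℚ.0ℚ ℚ.≤ E
    0≤E = expPartial-nonNeg 0≤x n
    copies-bound : copies H ℓ ≤ 2 * choose κ ℓ * choose D ℓ
    copies-bound = copies-≤ H ℓ u v b (subst (λ s → ¬ ContainsK H s) (sym ℓ+u≡t) noK) κ≡ trade
    choose-bound : choose D ℓ * suc r ^ q ≤ choose (κ ∸ ℓ) ℓ * r ^ q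
    choose-bound = subst (λ m → choose D ℓ * suc r ^ q ≤ choose m ℓ * r ^ q)
      (sym (trans (cong (_∸ ℓ) κ≡) (m+n∸m≡n ℓ (D + q)))) (choose-growth ℓ r q D growth)
    exp-bound : E ℚ.* pow z q ℚ.≤ ℚ.1ℚ
    exp-bound = expPartial-*-pow≤1 y z (ratio ℓ t) q (*-mono-< 0<ℓ b-pos) (/-nonNeg 1 r) (/-nonNeg r r) z+y≡1 0≤x
      (ratio-≤ ℓ t b r 0<t rate) n
      where
      z+y≡1 : z ℚ.+ y ≡ ℚ.1ℚ
      z+y≡1 = trans (/-+ r 1 r) (/-≡ (r + 1) r 1 0 (trans (*-identityʳ _) (trans (+-comm r 1) (sym (*-identityˡ (suc r))))))

  quotient : ∀ m n → 0 < n → ∃[ q ] q * n ≤ m × m < suc q * n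
  quotient m n 0<n = m / n , m/n*n≤m m n , (begin-strict
    m                   ≡⟨ m≡m%n+[m/n]*n m n ⟩
    m % n + m / n * n   <⟨ +-monoˡ-< (m / n * n) (m%n<n m n) ⟩
    n + m / n * n       ∎)
    where
    open ≤-Reasoning
    instance _ = >-nonZero 0<n

  [2b+3]t≤κ : ∀ t b′ κ → b′ * (16 * t) ≤ κ → 16 * t ≤ κ → (2 * suc b′ + 3) * t ≤ κ
  [2b+3]t≤κ t b′ κ b′16t≤κ 16t≤κ = *-cancelˡ-≤ 16 (begin
    16 * ((2 * suc b′ + 3) * t)          ≡⟨ expand t b′ ⟩
    2 * (b′ * (16 * t)) + 5 * (16 * t)   ≤⟨ +-mono-≤ (*-monoʳ-≤ 2 b′16t≤κ) (*-monoʳ-≤ 5 16t≤κ) ⟩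
    2 * κ + 5 * κ                        ≡⟨ *-distribʳ-+ κ 2 5 ⟨
    7 * κ                                ≤⟨ *-monoˡ-≤ κ (m≤m+n 7 9) ⟩
    16 * κ                               ∎)
    where
    open ≤-Reasoning
    expand : ∀ t b′ → 16 * ((2 * suc b′ + 3) * t) ≡ 2 * (b′ * (16 * t)) + 5 * (16 * t)
    expand = solve-∀

  split-κ : ∀ κ ℓ u b → (2 * b + 3) * (ℓ + u) ≤ κ →
    ∃[ v ] κ ≡ ℓ + (ℓ + u + v + ℓ * b) × suc b * (u + ℓ) + (u + ℓ) ≤ ℓ + u + v + suc b
  split-κ κ ℓ u b [2b+3]t≤κ with m≤n⇒∃[o]m+o≡n (≤-trans budget [2b+3]t≤κ)
    where
    budget : ℓ + u + ℓ + ℓ * b + suc b * (ℓ + u) ≤ (2 * b + 3) * (ℓ + u)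
    budget = begin
      ℓ + u + ℓ + ℓ * b + suc b * (ℓ + u)
        ≤⟨ +-monoˡ-≤ _ (+-mono-≤ (+-monoʳ-≤ (ℓ + u) (m≤m+n ℓ u)) (*-monoˡ-≤ b (m≤m+n ℓ u))) ⟩
      ℓ + u + (ℓ + u) + (ℓ + u) * b + suc b * (ℓ + u)
        ≡⟨ collect (ℓ + u) b ⟩
      (2 * b + 3) * (ℓ + u) ∎
      where
      open ≤-Reasoning
      collect : ∀ t b → t + t + t * b + suc b * t ≡ (2 * b + 3) * t
      collect = solve-∀
  ... | w , refl = suc b * (ℓ + u) + w , rearrange ℓ u b w , (begin
    suc b * (u + ℓ) + (u + ℓ)                          ≡⟨ cong (λ t → suc b * t + t) (+-comm u ℓ) ⟩
    suc b * (ℓ + u) + (ℓ + u)                          ≤⟨ m≤m+n _ (w + suc b) ⟩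
    suc b * (ℓ + u) + (ℓ + u) + (w + suc b)            ≡⟨ rearrange′ ℓ u b w ⟩
    ℓ + u + (suc b * (ℓ + u) + w) + suc b              ∎)
    where
    open ≤-Reasoning
    rearrange : ∀ ℓ u b w → ℓ + u + ℓ + ℓ * b + suc b * (ℓ + u) + w ≡ ℓ + (ℓ + u + (suc b * (ℓ + u) + w) + ℓ * b)
    rearrange = solve-∀
    rearrange′ : ∀ ℓ u b w → suc b * (ℓ + u) + (ℓ + u) + (w + suc b) ≡ ℓ + u + (suc b * (ℓ + u) + w) + suc b
    rearrange′ = solve-∀

  quotient-≥2 : ∀ κ ℓ → 0 < ℓ → 2 * ℓ ≤ κ → ∃[ r ] 0 < r × suc r * ℓ ≤ κ × κ < suc (suc r) * ℓ
  quotient-≥2 κ ℓ 0<ℓ 2ℓ≤κ with quotient κ ℓ 0<ℓ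
  ... | suc (suc r₀) , lo , hi = suc r₀ , s≤s z≤n , lo , hi
  ... | 0 , _ , κ<ℓ = contradiction (≤-trans (+-monoʳ-≤ ℓ z≤n) 2ℓ≤κ) (<⇒≱ κ<ℓ)
  ... | 1 , _ , κ<2ℓ = contradiction 2ℓ≤κ (<⇒≱ κ<2ℓ)

  parameters : ∀ κ t ℓ → 0 < ℓ → ℓ < t → 16 * t ≤ κ → Parameters κ t ℓ
  parameters κ t ℓ 0<ℓ ℓ<t 16t≤κ = from-quotients (quotient κ (16 * t) 0<16t) (quotient-≥2 κ ℓ 0<ℓ 2ℓ≤κ)
    where
    0<16t : 0 < 16 * t
    0<16t = *-mono-< {0} {16} {0} {t} (s≤s z≤n) (≤-<-trans z≤n ℓ<t)
    2ℓ≤κ : 2 * ℓ ≤ κ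
    2ℓ≤κ = ≤-trans (*-mono-≤ (m≤m+n 2 14) (<⇒≤ ℓ<t)) 16t≤κ
    u : ℕ
    u = proj₁ (m≤n⇒∃[o]m+o≡n (<⇒≤ ℓ<t))
    ℓ+u≡t : ℓ + u ≡ t
    ℓ+u≡t = proj₂ (m≤n⇒∃[o]m+o≡n (<⇒≤ ℓ<t))
    from-quotients : ∃[ b′ ] b′ * (16 * t) ≤ κ × κ < suc b′ * (16 * t) →
                     ∃[ r ] 0 < r × suc r * ℓ ≤ κ × κ < suc (suc r) * ℓ → Parameters κ t ℓ
    from-quotients (b′ , b′16t≤κ , κ<b16t) (r , 0<r , [r+1]ℓ≤κ , κ<[r+2]ℓ) = record
      { u = u ; v = proj₁ split ; b = suc b′ ; r = r ; ℓ+u≡t = ℓ+u≡t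
      ; κ≡ = proj₁ (proj₂ split) ; trade = proj₂ (proj₂ split)
      ; b-pos = s≤s z≤n ; r-pos = 0<r
      ; growth = <⇒≤ (+-cancelˡ-< ℓ _ _ (subst (_< ℓ + suc r * ℓ) (proj₁ (proj₂ split)) κ<[r+2]ℓ))
      ; rate = <⇒≤ (≤-<-trans [r+1]ℓ≤κ κ<b16t) }
      where
      room : (2 * suc b′ + 3) * (ℓ + u) ≤ κ
      room = subst (λ s → (2 * suc b′ + 3) * s ≤ κ) (sym ℓ+u≡t) ([2b+3]t≤κ t b′ κ b′16t≤κ 16t≤κ)
      split : ∃[ v ] κ ≡ ℓ + (ℓ + u + v + ℓ * suc b′)
                     × suc (suc b′) * (u + ℓ) + (u + ℓ) ≤ ℓ + u + v + suc (suc b′)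
      split = split-κ κ ℓ u (suc b′) room

open import Defs
open import Data.Nat using (ℕ; _<_; _≤_; _*_; _∸_)
open import Data.Nat.Combinatorics using (_C_)
open import Relation.Nullary using (¬_)
open import Relation.Binary.PropositionalEquality using (subst; cong₂)
import Data.Rational as ℚ
open Binomial using (choose≡C)
open Rationals using (fromℕ)
open Assembly using (copies-*-expPartial-≤; parameters)

lemma4p6 : (κ t ℓ : ℕ) → 0 < κ → 0 < t → 0 < ℓ → ℓ < t → 16 * t ≤ κ →
    (H : Graph κ) → ¬ ContainsK H t →
    LeTwoExpNegTimes (copies H ℓ) (ratio ℓ t) ((κ C ℓ) * ((κ ∸ ℓ) C ℓ))
lemma4p6 κ t ℓ _ 0<t 0<ℓ ℓ<t 16t≤κ H noK n =
  subst (λ m → fromℕ (copies H ℓ) ℚ.* expPartial (ratio ℓ t) n ℚ.≤ fromℕ (2 * m))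
    (cong₂ _*_ (choose≡C κ ℓ) (choose≡C (κ ∸ ℓ) ℓ))
    (copies-*-expPartial-≤ H t ℓ 0<t 0<ℓ noK (parameters κ t ℓ 0<ℓ ℓ<t 16t≤κ) n)
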